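{- Let $G_1$ and $G_2$ be two disjoint equidominating graphs, and let $G$ be a chain-join of $G_1$ and $G_2$. Then $G$ is equidominating. Moreover, if $G_1$ and $G_2$ are hereditarily equidominating, then so is $G$.
   Context: All graphs are finite, simple and undirected; $\mathbb{N}=\{1,2,\dots\}$. An mds of $G=(V,E)$ is an inclusion-minimal set $D\subseteq V$ such that every vertex is in $D$ or adjacent to a vertex of $D$. $G$ is equidominating if there exist $t\in\mathbb{N}$ and $w\colon V\to\mathbb{N}$ such that for all $D\subseteq V$: $D$ is an mds iff $\sum_{v\in D}w(v)=t$; $G$ is hereditarily equidominating if every induced subgraph of $G$ is equidominating. A universal vertex is adjacent to all other vertices. A chain graph is a bipartite graph in which the neighborhoods of the vertices on each side are pairwise comparable under inclusion. For disjoint graphs $G_1,G_2$ with $U_i$ the (possibly empty) set of universal vertices of $G_i$, and any chain graph $B$ with bipartition $U_1,U_2$, the graph $(G_1\cup G_2)+E(B)$ is a chain-join of $G_1$ and $G_2$. -}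

module Defs where

open import Data.Nat using (ℕ; suc; _+_; _≤_)
open import Data.Bool using (Bool; true; false; if_then_else_)
open import Data.Fin using (Fin; splitAt)
open import Data.Fin.Subset using (Subset; _∈_; _⊂_)
open import Data.Vec using (Vec; sum; tabulate; lookup)
open import Data.Sum using (_⊎_; inj₁; inj₂)
open import Data.Product using (Σ; ∃; _×_; _,_)
open import Relation.Binary.PropositionalEquality using (_≡_; _≢_; refl)
open import Relation.Nullary using (¬_)
open import Function.Bundles using (_⇔_)
open import Function.Definitions using (Injective)

record Graph (n : ℕ) : Set where
  field
    adj    : Fin n → Fin n → Bool
    irrefl : ∀ x → adj x x ≡ false
    sym    : ∀ x y → adj x y ≡ adj y x
open Graph public

Dominating : ∀ {n} → Graph n → Subset n → Set
Dominating G D = ∀ v → v ∈ D ⊎ ∃ λ u → u ∈ D × adj G u v ≡ true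

IsMDS : ∀ {n} → Graph n → Subset n → Set
IsMDS G D = Dominating G D × (∀ D′ → D′ ⊂ D → ¬ Dominating G D′)

weight : ∀ {n} → (Fin n → ℕ) → Subset n → ℕ
weight w D = sum (tabulate λ i → if lookup D i then w i else 0)

Equidominating : ∀ {n} → Graph n → Set
Equidominating {n} G =
  Σ (Fin n → ℕ) λ w → (∀ v → 1 ≤ w v) ×
  Σ ℕ λ t → 1 ≤ t × (∀ (D : Subset n) → IsMDS G D ⇔ (weight w D ≡ t))

induced : ∀ {m n} → Graph n → (f : Fin m → Fin n) → Graph m
induced G f = record
  { adj = λ i j → adj G (f i) (f j)
  ; irrefl = λ i → irrefl G (f i)
  ; sym = λ i j → sym G (f i) (f j) }

-- every (nonempty) induced subgraph is equidominating
HereditarilyEquidominating : ∀ {n} → Graph n → Set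
HereditarilyEquidominating {n} G =
  ∀ m (f : Fin (suc m) → Fin n) → Injective _≡_ _≡_ f → Equidominating (induced G f)

Universal : ∀ {n} → Graph n → Fin n → Set
Universal G u = ∀ v → v ≢ u → adj G u v ≡ true

-- B : Fin n₁ → Fin n₂ → Bool describes the edge set of a bipartite graph
-- between V(G₁) and V(G₂). It is a chain graph with bipartition U₁, U₂
-- (the sets of universal vertices) iff its edges join universal vertices
-- and the neighbourhoods on each side are pairwise comparable.
IsChainGraphOnUniversals : ∀ {n₁ n₂} → Graph n₁ → Graph n₂ → (Fin n₁ → Fin n₂ → Bool) → Set
IsChainGraphOnUniversals {n₁} {n₂} G₁ G₂ B =
  (∀ x y → B x y ≡ true → Universal G₁ x × Universal G₂ y) ×
  (∀ x x′ → Universal G₁ x → Universal G₁ x′ →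
     (∀ y → B x y ≡ true → B x′ y ≡ true) ⊎ (∀ y → B x′ y ≡ true → B x y ≡ true)) ×
  (∀ y y′ → Universal G₂ y → Universal G₂ y′ →
     (∀ x → B x y ≡ true → B x y′ ≡ true) ⊎ (∀ x → B x y′ ≡ true → B x y ≡ true))

joinAdj : ∀ {n₁ n₂} → Graph n₁ → Graph n₂ → (Fin n₁ → Fin n₂ → Bool) →
          Fin n₁ ⊎ Fin n₂ → Fin n₁ ⊎ Fin n₂ → Bool
joinAdj G₁ G₂ B (inj₁ a) (inj₁ b) = adj G₁ a b
joinAdj G₁ G₂ B (inj₁ a) (inj₂ b) = B a b
joinAdj G₁ G₂ B (inj₂ a) (inj₁ b) = B b a
joinAdj G₁ G₂ B (inj₂ a) (inj₂ b) = adj G₂ a b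

joinAdj-irrefl : ∀ {n₁ n₂} (G₁ : Graph n₁) (G₂ : Graph n₂) B s → joinAdj G₁ G₂ B s s ≡ false
joinAdj-irrefl G₁ G₂ B (inj₁ a) = irrefl G₁ a
joinAdj-irrefl G₁ G₂ B (inj₂ a) = irrefl G₂ a

joinAdj-sym : ∀ {n₁ n₂} (G₁ : Graph n₁) (G₂ : Graph n₂) B s r → joinAdj G₁ G₂ B s r ≡ joinAdj G₁ G₂ B r s
joinAdj-sym G₁ G₂ B (inj₁ a) (inj₁ b) = sym G₁ a b
joinAdj-sym G₁ G₂ B (inj₁ a) (inj₂ b) = refl
joinAdj-sym G₁ G₂ B (inj₂ a) (inj₁ b) = refl
joinAdj-sym G₁ G₂ B (inj₂ a) (inj₂ b) = sym G₂ a b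

-- the graph (G₁ ∪ G₂) + E(B) on Fin (n₁ + n₂): first n₁ vertices are G₁
chainJoin : ∀ {n₁ n₂} → Graph n₁ → Graph n₂ → (Fin n₁ → Fin n₂ → Bool) → Graph (n₁ + n₂)
chainJoin {n₁} G₁ G₂ B = record
  { adj = λ x y → joinAdj G₁ G₂ B (splitAt n₁ x) (splitAt n₁ y)
  ; irrefl = λ x → joinAdj-irrefl G₁ G₂ B (splitAt n₁ x)
  ; sym = λ x y → joinAdj-sym G₁ G₂ B (splitAt n₁ x) (splitAt n₁ y) }

-- Let G be the chain-join of G₁ and G₂ and S = S₁ ⊎ S₂ a set of its vertices.
-- An mds D of G[S] either contains a vertex f universal in G[S], and then
-- D = {f}, or it contains none, and then D is an mds iff its parts are mds's
-- of G₁[S₁] and G₂[S₂]; the chain condition on B is what makes the parts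
-- dominate and stay minimal.  Given equidominating weights (w₁ , t₁) and
-- (w₂ , t₂) of the sides, weigh universal vertices by T = t₁·a + t₂, other
-- left vertices by w₁·a and other right vertices by w₂, where a exceeds
-- every right-side weight; uniqueness of division by a then makes
-- "w(D) = T" equivalent to being an mds.
--
-- To treat whole graphs and induced subgraphs alike, everything is phrased
-- for a subset S of a finite vertex type (where the empty subgraph is
-- equidominating with target 0) and moved along embeddings.
module Submission where

open import Defs hiding (sym)
open import Data.Nat using (ℕ; zero; suc; _+_; _*_; _≤_; _<_; z≤n; s≤s; NonZero)
open import Data.Nat.Properties
  using (+-assoc; +-comm; +-identityʳ; +-cancelˡ-≡; *-cancelʳ-≡; ≤-refl; ≤-trans; <-irrefl; m≤m+n; m≤n+m;
         +-mono-≤; +-monoʳ-≤; *-mono-≤; m+1+n≰m; +-commutativeSemigroup; +-0-commutativeMonoid; +-*-semiring;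
         module ≤-Reasoning)
open import Data.Nat.DivMod using (_%_; [m+kn]%n≡m%n; m<n⇒m%n≡m)
open import Algebra.Properties.CommutativeSemigroup +-commutativeSemigroup using (x∙yz≈y∙xz)
open import Algebra.Properties.CommutativeMonoid.Sum +-0-commutativeMonoid using (sum; sum-cong-≗; sum-replicate-zero; ∑-comm)
open import Algebra.Properties.Semiring.Sum +-*-semiring using (*-distribʳ-sum)
open import Data.Bool using (Bool; true; false; if_then_else_; _∧_)
open import Data.Bool.Properties using (¬-not) renaming (_≟_ to _≟ᵇ_)
open import Data.Fin using (Fin; zero; suc; splitAt; join; _↑ˡ_; _↑ʳ_)
open import Data.Fin.Properties using (any?; all?; suc-injective; splitAt-join; join-splitAt) renaming (_≟_ to _≟ᶠ_)
open import Data.Fin.Subset using (Subset)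
open import Data.Vec using ([]; tabulate; lookup; _[_]=_)
import Data.Vec as Vec
open import Data.Vec.Properties using (lookup∘tabulate; []=⇒lookup; lookup⇒[]=)
open import Data.Sum using (_⊎_; inj₁; inj₂; [_,_]; [_,_]′; swap)
open import Data.Sum.Properties using (≡-dec; swap-involutive)
open import Data.Product using (Σ; Σ-syntax; ∃; _×_; _,_; proj₁; proj₂) renaming (swap to swap-×)
open import Data.Empty using (⊥; ⊥-elim)
open import Function using (flip; _∘_)
open import Function.Bundles using (_⇔_; mk⇔; Equivalence)
open import Function.Definitions using (Injective)
open import Relation.Binary.Definitions using (DecidableEquality)
open import Relation.Binary.PropositionalEquality
  using (_≡_; _≢_; _≗_; refl; sym; trans; cong; cong₂; subst; module ≡-Reasoning)
open import Relation.Nullary using (¬_; Dec; yes; no; does; ¬?)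
open import Relation.Nullary.Decidable using (map′; _×-dec_; _⊎-dec_; _→-dec_; dec-true; dec-false)

-- Besides congruence and ∑ 0 = 0 we only ask that one term can
-- be pulled out of the sum; all further summation facts follow from that.
record FiniteSum (V : Set) : Set where
  field
    _≟_    : DecidableEquality V
    ∑      : (V → ℕ) → ℕ
    ∑-cong : ∀ {f g} → f ≗ g → ∑ f ≡ ∑ g
    ∑-zero : ∑ (λ _ → 0) ≡ 0
    ∑-pick : ∀ g k → ∑ g ≡ g k + ∑ (λ v → if does (v ≟ k) then 0 else g v)

  _without_ : (V → ℕ) → V → V → ℕ
  (g without k) v = if does (v ≟ k) then 0 else g v

  without-≢ : ∀ g {k v} → v ≢ k → (g without k) v ≡ g v
  without-≢ g {k} {v} v≢k rewrite dec-false (v ≟ k) v≢k = refl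

  ∑-single : ∀ g k → (∀ v → v ≢ k → g v ≡ 0) → ∑ g ≡ g k
  ∑-single g k off = begin
    ∑ g                       ≡⟨ ∑-pick g k ⟩
    g k + ∑ (g without k)     ≡⟨ cong (g k +_) (trans (∑-cong vanish) ∑-zero) ⟩
    g k + 0                   ≡⟨ +-identityʳ (g k) ⟩
    g k                       ∎
    where
    open ≡-Reasoning
    vanish : g without k ≗ λ _ → 0
    vanish v with v ≟ k
    ... | yes _   = refl
    ... | no v≢k  = off v v≢k

  ∑-point : ∀ g k → g k ≤ ∑ g
  ∑-point g k rewrite ∑-pick g k = m≤m+n (g k) _

  ∑-two : ∀ g {k l} → l ≢ k → g k + g l ≤ ∑ g
  ∑-two g {k} {l} l≢k rewrite ∑-pick g k =
    +-monoʳ-≤ (g k) (subst (_≤ ∑ (g without k)) (without-≢ g l≢k) (∑-point (g without k) l))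



finSum : ∀ n → FiniteSum (Fin n)
finSum n = record
  { _≟_    = _≟ᶠ_
  ; ∑      = sum
  ; ∑-cong = sum-cong-≗
  ; ∑-zero = sum-replicate-zero n
  ; ∑-pick = pick }
  where
  pick : ∀ {m} (g : Fin m → ℕ) k → sum g ≡ g k + sum (λ v → if does (v ≟ᶠ k) then 0 else g v)
  pick g zero    = refl
  pick g (suc k) = trans (cong (g zero +_) (pick (λ i → g (suc i)) k)) (x∙yz≈y∙xz (g zero) (g (suc k)) _)

⊎-sum : ∀ {A B} → FiniteSum A → FiniteSum B → FiniteSum (A ⊎ B)
⊎-sum {A} {B} SA SB = record
  { _≟_    = ≡-dec (FiniteSum._≟_ SA) (FiniteSum._≟_ SB)
  ; ∑      = ∑⊎
  ; ∑-cong = λ f≗g → cong₂ _+_ (FiniteSum.∑-cong SA (λ x → f≗g (inj₁ x))) (FiniteSum.∑-cong SB (λ y → f≗g (inj₂ y)))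
  ; ∑-zero = cong₂ _+_ (FiniteSum.∑-zero SA) (FiniteSum.∑-zero SB)
  ; ∑-pick = pick }
  where
  ∑⊎ : (A ⊎ B → ℕ) → ℕ
  ∑⊎ g = FiniteSum.∑ SA (λ x → g (inj₁ x)) + FiniteSum.∑ SB (λ y → g (inj₂ y))
  pick : ∀ g k → ∑⊎ g ≡ g k + ∑⊎ (λ v → if does (≡-dec (FiniteSum._≟_ SA) (FiniteSum._≟_ SB) v k) then 0 else g v)
  pick g (inj₁ k) = trans (cong (_+ _) (FiniteSum.∑-pick SA (λ x → g (inj₁ x)) k)) (+-assoc (g (inj₁ k)) _ _)
  pick g (inj₂ k) = trans (cong (_ +_) (FiniteSum.∑-pick SB (λ y → g (inj₂ y)) k)) (x∙yz≈y∙xz (FiniteSum.∑ SA (λ x → g (inj₁ x))) (g (inj₂ k)) _)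

sum-mono : ∀ {n} {f g : Fin n → ℕ} → (∀ i → f i ≤ g i) → sum f ≤ sum g
sum-mono {zero}  f≤g = z≤n
sum-mono {suc n} f≤g = +-mono-≤ (f≤g zero) (sum-mono (λ i → f≤g (suc i)))

sum-splitAt : ∀ m {n} (g : Fin (m + n) → ℕ) → sum g ≡ sum (λ i → g (i ↑ˡ n)) + sum (λ j → g (m ↑ʳ j))
sum-splitAt zero    g = refl
sum-splitAt (suc m) g = trans (cong (g zero +_) (sum-splitAt m (g ∘ suc))) (sym (+-assoc (g zero) _ _))

-- A sum over Fin N of a function vanishing off the image of an injection e
-- equals the sum along e: expand g v = ∑ᵢ [e i = v] g v and swap the sums.
sum-image : ∀ {k N} (e : Fin k → Fin N) → Injective _≡_ _≡_ e → (T : Fin N → Bool) →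
  (∀ v → T v ≡ true → ∃ λ i → e i ≡ v) → ∀ g → (∀ v → T v ≡ false → g v ≡ 0) → sum g ≡ sum (g ∘ e)
sum-image {k} {N} e inj T onto g vanish = begin
  sum g                             ≡⟨ sum-cong-≗ expand ⟩
  sum (λ v → sum (λ i → δ v i))     ≡⟨ ∑-comm δ ⟩
  sum (λ i → sum (λ v → δ v i))     ≡⟨ sum-cong-≗ collapse ⟩
  sum (g ∘ e)                       ∎
  where
  open ≡-Reasoning
  δ : Fin N → Fin k → ℕ
  δ v i = if does (e i ≟ᶠ v) then g v else 0
  δ-diagonal : ∀ i → δ (e i) i ≡ g (e i)
  δ-diagonal i rewrite dec-true (e i ≟ᶠ e i) refl = refl
  collapse : ∀ i → sum (λ v → δ v i) ≡ g (e i)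
  collapse i = trans (FiniteSum.∑-single (finSum N) (λ v → δ v i) (e i) off) (δ-diagonal i)
    where
    off : ∀ v → v ≢ e i → δ v i ≡ 0
    off v v≢ei rewrite dec-false (e i ≟ᶠ v) (v≢ei ∘ sym) = refl
  expand : ∀ v → g v ≡ sum (λ i → δ v i)
  expand v with T v in v∈T
  ... | true with onto v v∈T
  ...   | i₀ , refl = sym (trans (FiniteSum.∑-single (finSum k) (δ (e i₀)) i₀ off) (δ-diagonal i₀))
    where
    off : ∀ i → i ≢ i₀ → δ (e i₀) i ≡ 0
    off i i≢i₀ rewrite dec-false (e i ≟ᶠ e i₀) (i≢i₀ ∘ inj) = refl
  expand v | false = trans (vanish v v∈T) (sym (trans (sum-cong-≗ no-term) (sum-replicate-zero k)))
    where
    no-term : ∀ i → δ v i ≡ 0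
    no-term i with does (e i ≟ᶠ v)
    ... | true  = vanish v v∈T
    ... | false = refl

euclid-unique : ∀ {a p q r s} .{{_ : NonZero a}} → r < a → s < a → p * a + r ≡ q * a + s → p ≡ q × r ≡ s
euclid-unique {a} {p} {q} {r} {s} r<a s<a eq = *-cancelʳ-≡ p q a (+-cancelˡ-≡ r _ _ (trans eq′ (cong (_+ q * a) (sym r≡s)))) , r≡s
  where
  open ≡-Reasoning
  eq′ : r + p * a ≡ s + q * a
  eq′ = trans (+-comm r (p * a)) (trans eq (+-comm (q * a) s))
  r≡s : r ≡ s
  r≡s = begin
    r                 ≡⟨ sym (m<n⇒m%n≡m r<a) ⟩
    r % a             ≡⟨ sym ([m+kn]%n≡m%n r p a) ⟩
    (r + p * a) % a   ≡⟨ cong (_% a) eq′ ⟩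
    (s + q * a) % a   ≡⟨ [m+kn]%n≡m%n s q a ⟩
    s % a             ≡⟨ m<n⇒m%n≡m s<a ⟩
    s                 ∎

true≢false : ∀ {b : Bool} → b ≡ true → b ≡ false → ⊥
true≢false refl ()

module _ {V : Set} where

  _⊆_ : (V → Bool) → (V → Bool) → Set
  D ⊆ E = ∀ v → D v ≡ true → E v ≡ true

  _⊊_ : (V → Bool) → (V → Bool) → Set
  D ⊊ E = D ⊆ E × ∃ λ v → E v ≡ true × D v ≡ false

  Dominates : (V → V → Bool) → (V → Bool) → (V → Bool) → Set
  Dominates A S D = ∀ v → S v ≡ true → D v ≡ true ⊎ ∃ λ u → D u ≡ true × A u v ≡ true

  IsMDSIn : (V → V → Bool) → (V → Bool) → (V → Bool) → Set
  IsMDSIn A S D = D ⊆ S × Dominates A S D × (∀ E → E ⊊ D → ¬ Dominates A S E)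

  UniversalIn : (V → V → Bool) → (V → Bool) → V → Set
  UniversalIn A S f = S f ≡ true × (∀ v → S v ≡ true → v ≢ f → A f v ≡ true)

  NoUniversalIn : (V → V → Bool) → (V → Bool) → (V → Bool) → Set
  NoUniversalIn A S D = ∀ v → D v ≡ true → ¬ UniversalIn A S v

  weightIn : FiniteSum V → (V → ℕ) → (V → Bool) → ℕ
  weightIn fs w D = FiniteSum.∑ fs (λ v → if D v then w v else 0)

  -- Unlike the notion on
  -- whole graphs the target may be 0; this makes the empty subgraph
  -- equidominating, and t ≥ 1 is automatic as soon as S is non-empty.
  EquidominatingIn : FiniteSum V → (V → V → Bool) → (V → Bool) → Set
  EquidominatingIn fs A S =
    Σ[ w ∈ (V → ℕ) ] (∀ v → S v ≡ true → 1 ≤ w v) ×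
    Σ[ t ∈ ℕ ] (∀ D → D ⊆ S → IsMDSIn A S D ⇔ weightIn fs w D ≡ t)

  dominates-mono : ∀ {A S D E} → D ⊆ E → Dominates A S D → Dominates A S E
  dominates-mono D⊆E dom v v∈S with dom v v∈S
  ... | inj₁ v∈D            = inj₁ (D⊆E v v∈D)
  ... | inj₂ (u , u∈D , uv) = inj₂ (u , D⊆E u u∈D , uv)

  mds-cong : ∀ {A S D E} → D ≗ E → IsMDSIn A S D → IsMDSIn A S E
  mds-cong {D = D} {E} D≗E (D⊆S , dom , minimal) =
    (λ v v∈E → D⊆S v (from v v∈E)) ,
    dominates-mono to dom ,
    λ F (F⊆E , v , v∈E , v∉F) → minimal F ((λ u u∈F → from u (F⊆E u u∈F)) , v , from v v∈E , v∉F)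
    where
    to : D ⊆ E
    to v v∈D = trans (sym (D≗E v)) v∈D
    from : E ⊆ D
    from v v∈E = trans (D≗E v) v∈E

  empty-dominates : ∀ {A S} → Dominates A S (λ _ → false) → ∀ v → S v ≡ false
  empty-dominates {S = S} dom v with S v in v∈S
  ... | false = refl
  ... | true with dom v v∈S
  ...   | inj₁ ()
  ...   | inj₂ (_ , () , _)

module FiniteVertices {V : Set} (fs : FiniteSum V) where
  open FiniteSum fs using (_≟_; ∑-single; ∑-two; ∑-zero; ∑-cong)

  ⁅_⁆ : V → V → Bool
  ⁅ f ⁆ v = does (v ≟ f)

  ⁅⁆-self : ∀ f → ⁅ f ⁆ f ≡ true
  ⁅⁆-self f = dec-true (f ≟ f) refl

  ⁅⁆-≢ : ∀ {f v} → v ≢ f → ⁅ f ⁆ v ≡ false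
  ⁅⁆-≢ {f} {v} = dec-false (v ≟ f)

  ∈⁅⁆ : ∀ {f v} → ⁅ f ⁆ v ≡ true → v ≡ f
  ∈⁅⁆ {f} {v} v∈f with v ≟ f
  ... | yes v≡f = v≡f
  ... | no  _   = ⊥-elim (true≢false v∈f refl)

  ⁅⁆-unique : ∀ {D f} → D f ≡ true → (∀ v → D v ≡ true → v ≡ f) → D ≗ ⁅ f ⁆
  ⁅⁆-unique {D} {f} f∈D only-f v with v ≟ f
  ... | yes refl = f∈D
  ... | no  v≢f with D v in v∈D
  ...   | false = refl
  ...   | true  = ⊥-elim (v≢f (only-f v v∈D))

  _─_ : (V → Bool) → V → V → Bool
  (D ─ u) v = if does (v ≟ u) then false else D v

  ─-≢ : ∀ D {u v} → v ≢ u → (D ─ u) v ≡ D v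
  ─-≢ D {u} {v} v≢u rewrite dec-false (v ≟ u) v≢u = refl

  ─-⊊ : ∀ D {u} → D u ≡ true → (D ─ u) ⊊ D
  ─-⊊ D {u} u∈D = removed-⊆ , u , u∈D , removed-self
    where
    removed-⊆ : (D ─ u) ⊆ D
    removed-⊆ v v∈D─u with v ≟ u
    ... | yes _ = ⊥-elim (true≢false v∈D─u refl)
    ... | no  _ = v∈D─u
    removed-self : (D ─ u) u ≡ false
    removed-self rewrite dec-true (u ≟ u) refl = refl

  module _ {A : V → V → Bool} {S : V → Bool} where

    universal-mds : ∀ {f} → UniversalIn A S f → IsMDSIn A S ⁅ f ⁆
    universal-mds {f} (f∈S , f-adj) = ⁅f⁆⊆S , dominates , minimal
      where
      ⁅f⁆⊆S : ⁅ f ⁆ ⊆ S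
      ⁅f⁆⊆S v v∈f = subst (λ u → S u ≡ true) (sym (∈⁅⁆ v∈f)) f∈S
      dominates : Dominates A S ⁅ f ⁆
      dominates v v∈S with v ≟ f
      ... | yes _   = inj₁ refl
      ... | no  v≢f = inj₂ (f , ⁅⁆-self f , f-adj v v∈S v≢f)
      minimal : ∀ E → E ⊊ ⁅ f ⁆ → ¬ Dominates A S E
      minimal E (E⊆f , v , v∈f , v∉E) dom with dom f f∈S
      ... | inj₁ f∈E            = true≢false f∈E (subst (λ u → E u ≡ false) (∈⁅⁆ v∈f) v∉E)
      ... | inj₂ (u , u∈E , _)  =
        true≢false u∈E (subst (λ x → E x ≡ false) (trans (∈⁅⁆ v∈f) (sym (∈⁅⁆ (E⊆f u u∈E)))) v∉E)

    mds-universal : ∀ {D f} → IsMDSIn A S D → D f ≡ true → UniversalIn A S f → D ≗ ⁅ f ⁆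
    mds-universal {D} {f} (_ , _ , minimal) f∈D uf = ⁅⁆-unique f∈D only-f
      where
      ⁅f⁆⊆D : ⁅ f ⁆ ⊆ D
      ⁅f⁆⊆D u u∈f = subst (λ x → D x ≡ true) (sym (∈⁅⁆ u∈f)) f∈D
      only-f : ∀ v → D v ≡ true → v ≡ f
      only-f v v∈D with v ≟ f
      ... | yes v≡f = v≡f
      ... | no  v≢f = ⊥-elim (minimal ⁅ f ⁆ (⁅f⁆⊆D , v , v∈D , ⁅⁆-≢ v≢f) (proj₁ (proj₂ (universal-mds uf))))

    -- A vertex u of an mds cannot have its closed neighbourhood inside that
    -- of another vertex u′ of the set: then D ─ u would still dominate.
    mds-irredundant : ∀ {D u u′} → IsMDSIn A S D → D u ≡ true → D u′ ≡ true → u′ ≢ u →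
      A u′ u ≡ true → (∀ v → S v ≡ true → A u v ≡ true → v ≡ u′ ⊎ A u′ v ≡ true) → ⊥
    mds-irredundant {D} {u} {u′} (_ , dom , minimal) u∈D u′∈D u′≢u u′u cover =
      minimal (D ─ u) (─-⊊ D u∈D) dominates
      where
      u′∈D─u : (D ─ u) u′ ≡ true
      u′∈D─u = trans (─-≢ D u′≢u) u′∈D
      dominated-by-u′ : ∀ {v} → v ≡ u′ ⊎ A u′ v ≡ true → (D ─ u) v ≡ true ⊎ ∃ λ x → (D ─ u) x ≡ true × A x v ≡ true
      dominated-by-u′ (inj₁ refl) = inj₁ u′∈D─u
      dominated-by-u′ (inj₂ u′v)  = inj₂ (u′ , u′∈D─u , u′v)
      dominates : Dominates A S (D ─ u)
      dominates v v∈S with dom v v∈S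
      ... | inj₁ v∈D with v ≟ u
      ...   | yes refl = inj₂ (u′ , u′∈D─u , u′u)
      ...   | no _     = inj₁ v∈D
      dominates v v∈S | inj₂ (x , x∈D , xv) with x ≟ u
      ...   | yes refl = dominated-by-u′ (cover v v∈S xv)
      ...   | no x≢u   = inj₂ (x , trans (─-≢ D x≢u) x∈D , xv)

  weight-singleton : ∀ w {D f} → D ≗ ⁅ f ⁆ → weightIn fs w D ≡ w f
  weight-singleton w {D} {f} D≗f = trans (∑-single _ f off) (cong (λ b → if b then w f else 0) f∈D)
    where
    f∈D : D f ≡ true
    f∈D = trans (D≗f f) (⁅⁆-self f)
    off : ∀ v → v ≢ f → (if D v then w v else 0) ≡ 0
    off v v≢f rewrite D≗f v | ⁅⁆-≢ v≢f = refl

  weight-pair : ∀ w {D f v} → D f ≡ true → D v ≡ true → v ≢ f → w f + w v ≤ weightIn fs w D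
  weight-pair w {D} {f} {v} f∈D v∈D v≢f =
    subst (_≤ weightIn fs w D) both-present (∑-two (λ u → if D u then w u else 0) v≢f)
    where
    both-present : (if D f then w f else 0) + (if D v then w v else 0) ≡ w f + w v
    both-present rewrite f∈D | v∈D = refl

  module _ {A : V → V → Bool} {S : V → Bool} where

    target-positive : ∀ {w t v} → (∀ D → D ⊆ S → IsMDSIn A S D ⇔ weightIn fs w D ≡ t) →
                      S v ≡ true → 1 ≤ t
    target-positive {w} {zero} {v} char v∈S =
      ⊥-elim (true≢false v∈S (empty-dominates (proj₁ (proj₂ empty-mds)) v))
      where
      empty-mds : IsMDSIn A S (λ _ → false)
      empty-mds = Equivalence.from (char (λ _ → false) (λ _ ())) ∑-zero
    target-positive {t = suc t} _ _ = s≤s z≤n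

    empty-equidominating : (∀ v → S v ≡ false) → EquidominatingIn fs A S
    empty-equidominating S-empty = (λ _ → 1) , (λ v v∈S → ⊥-elim (true≢false v∈S (S-empty v))) , 0 ,
      λ D D⊆S → mk⇔ (λ _ → trans (∑-cong (λ v → vanish D D⊆S v)) ∑-zero) (λ _ → empty-mds D D⊆S)
      where
      absent : ∀ D → D ⊆ S → ∀ v → D v ≡ false
      absent D D⊆S v with D v in v∈D
      ... | true  = ⊥-elim (true≢false (D⊆S v v∈D) (S-empty v))
      ... | false = refl
      vanish : ∀ D → D ⊆ S → ∀ v → (if D v then 1 else 0) ≡ 0
      vanish D D⊆S v rewrite absent D D⊆S v = refl
      empty-mds : ∀ D → D ⊆ S → IsMDSIn A S D
      empty-mds D D⊆S = D⊆S , (λ v v∈S → ⊥-elim (true≢false v∈S (S-empty v))) ,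
        λ E (_ , v , v∈D , _) _ → true≢false v∈D (absent D D⊆S v)

record Embedding {V W : Set} (AV : V → V → Bool) (SV : V → Bool)
                              (AW : W → W → Bool) (SW : W → Bool) : Set where
  field
    to      : V → W
    from    : W → V
    from-to : ∀ x → from (to x) ≡ x
    to-from : ∀ v → SW v ≡ true → to (from v) ≡ v
    adj-to  : ∀ x y → AW (to x) (to y) ≡ AV x y
    mem-to  : ∀ x → SW (to x) ≡ SV x

module _ {V W : Set} {AV : V → V → Bool} {SV : V → Bool} {AW : W → W → Bool} {SW : W → Bool}
         (e : Embedding AV SV AW SW) where
  open Embedding e

  preimage : ∀ v → SW v ≡ true → ∃ λ x → SV x ≡ true × to x ≡ v
  preimage v v∈SW = from v , trans (sym (mem-to (from v))) (subst (λ u → SW u ≡ true) (sym (to-from v v∈SW)) v∈SW) , to-from v v∈SW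

  dominates-back : ∀ {D} → D ⊆ SW → Dominates AW SW D → Dominates AV SV (λ x → D (to x))
  dominates-back D⊆SW dom x x∈SV with dom (to x) (trans (mem-to x) x∈SV)
  ... | inj₁ p = inj₁ p
  ... | inj₂ (u , u∈D , uv) with preimage u (D⊆SW u u∈D)
  ...   | y , _ , refl = inj₂ (y , u∈D , trans (sym (adj-to y x)) uv)

  dominates-forth : ∀ {D} → Dominates AV SV (λ x → D (to x)) → Dominates AW SW D
  dominates-forth dom v v∈SW with preimage v v∈SW
  ... | x , x∈SV , refl with dom x x∈SV
  ...   | inj₁ p = inj₁ p
  ...   | inj₂ (y , y∈D , yx) = inj₂ (to y , y∈D , trans (adj-to y x) yx)

  lift : (V → Bool) → W → Bool
  lift P v = SW v ∧ P (from v)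

  lift-to : ∀ {P} → P ⊆ SV → ∀ x → lift P (to x) ≡ P x
  lift-to {P} P⊆SV x rewrite mem-to x | from-to x with SV x in x∈SV | P x in x∈P
  ... | true  | _     = refl
  ... | false | false = refl
  ... | false | true  = ⊥-elim (true≢false (P⊆SV x x∈P) x∈SV)

  lift-⊆ : ∀ P → lift P ⊆ SW
  lift-⊆ P v v∈lift with SW v
  ... | true = refl

  mds-back : ∀ {D} → IsMDSIn AW SW D → IsMDSIn AV SV (λ x → D (to x))
  mds-back {D} (D⊆SW , dom , minimal) =
    (λ x x∈D → trans (sym (mem-to x)) (D⊆SW (to x) x∈D)) , dominates-back D⊆SW dom ,
    λ P (P⊆D , x , x∈D , x∉P) domP →
      let P⊆SV : P ⊆ SV
          P⊆SV y y∈P = trans (sym (mem-to y)) (D⊆SW (to y) (P⊆D y y∈P))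
      in minimal (lift P)
           (lift⊆D P⊆D , to x , x∈D , trans (lift-to P⊆SV x) x∉P)
           (dominates-forth (dominates-mono (λ y y∈P → trans (lift-to P⊆SV y) y∈P) domP))
    where
    lift⊆D : ∀ {P} → P ⊆ (λ x → D (to x)) → lift P ⊆ D
    lift⊆D {P} P⊆D v v∈lift with SW v in v∈SW
    ... | true = subst (λ u → D u ≡ true) (to-from v v∈SW) (P⊆D (from v) v∈lift)

  mds-forth : ∀ {D} → D ⊆ SW → IsMDSIn AV SV (λ x → D (to x)) → IsMDSIn AW SW D
  mds-forth {D} D⊆SW (_ , dom , minimal) = D⊆SW , dominates-forth dom ,
    λ E (E⊆D , v , v∈D , v∉E) domE → let (x , _ , x↦v) = preimage v (D⊆SW v v∈D) in
      minimal (λ y → E (to y))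
        ((λ y → E⊆D (to y)) , x , subst (λ u → D u ≡ true) (sym x↦v) v∈D , subst (λ u → E u ≡ false) (sym x↦v) v∉E)
        (dominates-back (λ u u∈E → D⊆SW u (E⊆D u u∈E)) domE)

  universal-forth : ∀ {x} → UniversalIn AV SV x → UniversalIn AW SW (to x)
  universal-forth {x} (x∈SV , x-adj) = trans (mem-to x) x∈SV , λ v v∈SW v≢x →
    let (y , y∈SV , y↦v) = preimage v v∈SW in
    subst (λ u → AW (to x) u ≡ true) y↦v
      (trans (adj-to x y) (x-adj y y∈SV (λ y≡x → v≢x (trans (sym y↦v) (cong to y≡x)))))

  SumsAgree : FiniteSum V → FiniteSum W → Set
  SumsAgree fsV fsW = ∀ g → (∀ v → SW v ≡ false → g v ≡ 0) →
                      FiniteSum.∑ fsW g ≡ FiniteSum.∑ fsV (λ x → g (to x))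

  module _ {fsV : FiniteSum V} {fsW : FiniteSum W} (agree : SumsAgree fsV fsW) where

    weight-to : ∀ w {D} → D ⊆ SW → weightIn fsW w D ≡ weightIn fsV (λ x → w (to x)) (λ x → D (to x))
    weight-to w {D} D⊆SW = agree _ vanish
      where
      vanish : ∀ v → SW v ≡ false → (if D v then w v else 0) ≡ 0
      vanish v v∉SW with D v in v∈D
      ... | true  = ⊥-elim (true≢false (D⊆SW v v∈D) v∉SW)
      ... | false = refl

    transfer : EquidominatingIn fsV AV SV → EquidominatingIn fsW AW SW
    transfer (w , w-pos , t , char) = (λ v → w (from v)) , pos , t , λ D D⊆SW →
      let charD = char (λ x → D (to x)) (λ x x∈D → trans (sym (mem-to x)) (D⊆SW (to x) x∈D)) in
      mk⇔ (λ M → trans (weight-eq D⊆SW) (Equivalence.to charD (mds-back M)))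
          (λ wt → mds-forth D⊆SW (Equivalence.from charD (trans (sym (weight-eq D⊆SW)) wt)))
      where
      pos : ∀ v → SW v ≡ true → 1 ≤ w (from v)
      pos v v∈SW = let (x , x∈SV , x↦v) = preimage v v∈SW in
        subst (λ u → 1 ≤ w (from u)) x↦v (subst (λ y → 1 ≤ w y) (sym (from-to x)) (w-pos x x∈SV))
      weight-eq : ∀ {D} → D ⊆ SW → weightIn fsW (λ v → w (from v)) D ≡ weightIn fsV w (λ x → D (to x))
      weight-eq {D} D⊆SW = trans (weight-to (λ v → w (from v)) D⊆SW)
        (FiniteSum.∑-cong fsV (λ x → cong (λ y → if D (to x) then w y else 0) (from-to x)))

    transfer⁻¹ : EquidominatingIn fsW AW SW → EquidominatingIn fsV AV SV
    transfer⁻¹ (w , w-pos , t , char) = (λ x → w (to x)) , pos , t , λ P P⊆SV →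
      let charL = char (lift P) (lift-⊆ P)
          P≗L : P ≗ λ x → lift P (to x)
          P≗L x = sym (lift-to P⊆SV x)
          weight-eq : weightIn fsW w (lift P) ≡ weightIn fsV (λ x → w (to x)) P
          weight-eq = trans (weight-to w (lift-⊆ P))
            (FiniteSum.∑-cong fsV (λ x → cong (λ b → if b then w (to x) else 0) (lift-to P⊆SV x)))
      in mk⇔ (λ M → trans (sym weight-eq) (Equivalence.to charL (mds-forth (lift-⊆ P) (mds-cong P≗L M))))
             (λ wt → mds-cong (λ x → sym (P≗L x)) (mds-back (Equivalence.from charL (trans weight-eq wt))))
      where
      pos : ∀ x → SV x ≡ true → 1 ≤ w (to x)
      pos x x∈SV = w-pos (to x) (trans (mem-to x) x∈SV)

full : ∀ {n} → Fin n → Bool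
full _ = true

sum-tabulate : ∀ {n} (g : Fin n → ℕ) → Vec.sum (tabulate g) ≡ sum g
sum-tabulate {zero}  g = refl
sum-tabulate {suc n} g = cong (g zero +_) (sum-tabulate (λ i → g (suc i)))

module WholeGraph {n : ℕ} (G : Graph n) where

  dominating→ : ∀ {D} → Dominating G D → Dominates (adj G) full (lookup D)
  dominating→ dom v _ with dom v
  ... | inj₁ v∈D            = inj₁ ([]=⇒lookup v∈D)
  ... | inj₂ (u , u∈D , uv) = inj₂ (u , []=⇒lookup u∈D , uv)

  dominating← : ∀ {D} → Dominates (adj G) full (lookup D) → Dominating G D
  dominating← {D} dom v with dom v refl
  ... | inj₁ v∈D            = inj₁ (lookup⇒[]= v D v∈D)
  ... | inj₂ (u , u∈D , uv) = inj₂ (u , lookup⇒[]= u D u∈D , uv)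

  isMDS→ : ∀ {D} → IsMDS G D → IsMDSIn (adj G) full (lookup D)
  isMDS→ {D} (dom , minimal) = (λ _ _ → refl) , dominating→ dom ,
    λ E (E⊆D , x , x∈D , x∉E) domE →
      minimal (tabulate E)
        ((λ {y} y∈E → lookup⇒[]= y D (E⊆D y (tabulated y∈E))) , x , lookup⇒[]= x D x∈D ,
         λ x∈E → true≢false (tabulated x∈E) x∉E)
        (dominating← (dominates-mono (λ v v∈E → trans (lookup∘tabulate E v) v∈E) domE))
    where
    tabulated : ∀ {E : Fin n → Bool} {y} → tabulate E [ y ]= true → E y ≡ true
    tabulated {E} {y} y∈E = trans (sym (lookup∘tabulate E y)) ([]=⇒lookup y∈E)

  isMDS← : ∀ {D} → IsMDSIn (adj G) full (lookup D) → IsMDS G D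
  isMDS← {D} (_ , dom , minimal) = dominating← dom ,
    λ D′ (D′⊆D , x , x∈D , x∉D′) domD′ →
      minimal (lookup D′)
        ((λ v v∈D′ → []=⇒lookup (D′⊆D (lookup⇒[]= v D′ v∈D′))) , x , []=⇒lookup x∈D , outside x∉D′)
        (dominating→ domD′)
    where
    outside : ∀ {D′ : Subset n} {x} → ¬ (D′ [ x ]= true) → lookup D′ x ≡ false
    outside {D′} {x} x∉D′ with lookup D′ x in x∈D′
    ... | true  = ⊥-elim (x∉D′ (lookup⇒[]= x D′ x∈D′))
    ... | false = refl

  weight-lookup : ∀ w D → weight w D ≡ weightIn (finSum n) w (lookup D)
  weight-lookup w D = sum-tabulate (λ i → if lookup D i then w i else 0)

  toRelative : Equidominating G → EquidominatingIn (finSum n) (adj G) full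
  toRelative (w , pos , t , _ , char) = w , (λ v _ → pos v) , t , λ D _ →
    let charD = char (tabulate D)
        weight-eq : weight w (tabulate D) ≡ weightIn (finSum n) w D
        weight-eq = trans (weight-lookup w (tabulate D))
          (FiniteSum.∑-cong (finSum n) (λ v → cong (λ b → if b then w v else 0) (lookup∘tabulate D v)))
    in mk⇔ (λ M → trans (sym weight-eq) (Equivalence.to charD (isMDS← {tabulate D} (mds-cong (λ v → sym (lookup∘tabulate D v)) M))))
           (λ wt → mds-cong (lookup∘tabulate D) (isMDS→ {tabulate D} (Equivalence.from charD (trans weight-eq wt))))

  fromRelative : Fin n → EquidominatingIn (finSum n) (adj G) full → Equidominating G
  fromRelative v (w , pos , t , char) =
    w , (λ u → pos u refl) , t , FiniteVertices.target-positive (finSum n) {v = v} char refl , λ D →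
      let charD = char (lookup D) (λ _ _ → refl) in
      mk⇔ (λ M → trans (weight-lookup w D) (Equivalence.to charD (isMDS→ M)))
          (λ wt → isMDS← (Equivalence.from charD (trans (sym (weight-lookup w D)) wt)))

-- An equidominating graph has a vertex: in the empty graph ∅ is an mds of weight 0.
equidominating-vertex : ∀ {n} (G : Graph n) → Equidominating G → Fin n
equidominating-vertex {zero} G (w , _ , t , 1≤t , char) =
  ⊥-elim (<-irrefl (Equivalence.to (char []) ((λ ()) , λ { _ (_ , () , _) _ })) 1≤t)
equidominating-vertex {suc n} G _ = zero

Enumeration : ∀ {n} → (Fin n → Bool) → Set
Enumeration {n} T = ∃ λ k → Σ (Fin k → Fin n) λ e →
  Injective _≡_ _≡_ e × (∀ i → T (e i) ≡ true) × (∀ v → T v ≡ true → ∃ λ i → e i ≡ v)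

enumerate : ∀ {n} (T : Fin n → Bool) → Enumeration T
enumerate {zero}  T = 0 , (λ ()) , (λ { {()} }) , (λ ()) , (λ ())
enumerate {suc n} T with enumerate (T ∘ suc) | T zero in 0∈T
... | k , e , inj , into , onto | true = suc k , e′ , inj′ , into′ , onto′
  where
  e′ : Fin (suc k) → Fin (suc n)
  e′ zero    = zero
  e′ (suc i) = suc (e i)
  inj′ : Injective _≡_ _≡_ e′
  inj′ {zero}  {zero}  _ = refl
  inj′ {suc i} {suc j} p = cong suc (inj (suc-injective p))
  into′ : ∀ i → T (e′ i) ≡ true
  into′ zero    = 0∈T
  into′ (suc i) = into i
  onto′ : ∀ v → T v ≡ true → ∃ λ i → e′ i ≡ v
  onto′ zero    _   = zero , refl
  onto′ (suc v) v∈T = let (i , p) = onto v v∈T in suc i , cong suc p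
... | k , e , inj , into , onto | false = k , suc ∘ e , inj ∘ suc-injective , into , onto′
  where
  onto′ : ∀ v → T v ≡ true → ∃ λ i → suc (e i) ≡ v
  onto′ zero    v∈T = ⊥-elim (true≢false v∈T 0∈T)
  onto′ (suc v) v∈T = let (i , p) = onto v v∈T in i , cong suc p

image-embedding : ∀ {m N} (G : Graph N) (f : Fin (suc m) → Fin N) → Injective _≡_ _≡_ f →
  (T : Fin N → Bool) → (∀ i → T (f i) ≡ true) → (∀ v → T v ≡ true → ∃ λ i → f i ≡ v) →
  Embedding (adj (induced G f)) full (adj G) T
image-embedding {m} {N} G f inj T into onto = record
  { to = f ; from = from ; from-to = from-to ; to-from = to-from ; adj-to = λ _ _ → refl ; mem-to = into }
  where
  from : Fin N → Fin (suc m)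
  from v with any? (λ i → f i ≟ᶠ v)
  ... | yes (i , _) = i
  ... | no  _       = zero
  from-to : ∀ x → from (f x) ≡ x
  from-to x with any? (λ i → f i ≟ᶠ f x)
  ... | yes (_ , fi≡fx) = inj fi≡fx
  ... | no  none        = ⊥-elim (none (x , refl))
  to-from : ∀ v → T v ≡ true → f (from v) ≡ v
  to-from v v∈T with any? (λ i → f i ≟ᶠ v)
  ... | yes (_ , fi≡v) = fi≡v
  ... | no  none       = ⊥-elim (none (onto v v∈T))

Image : ∀ {k N} → (Fin k → Fin N) → Fin N → Bool
Image f v = does (any? (λ i → f i ≟ᶠ v))

in-image : ∀ {k N} (f : Fin k → Fin N) i → Image f (f i) ≡ true
in-image f i = dec-true (any? (λ j → f j ≟ᶠ f i)) (i , refl)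

image-onto : ∀ {k N} (f : Fin k → Fin N) v → Image f v ≡ true → ∃ λ i → f i ≡ v
image-onto f v v∈f with any? (λ i → f i ≟ᶠ v)
... | yes p = p
... | no  _ = ⊥-elim (true≢false v∈f refl)

-- A hereditarily equidominating graph is equidominating on every vertex
-- subset T: a non-empty T is the image of an injection from some Fin (suc m),
-- and the empty subgraph is equidominating anyway.
hereditary-relative : ∀ {n} (G : Graph n) → HereditarilyEquidominating G → ∀ T → EquidominatingIn (finSum n) (adj G) T
hereditary-relative {n} G H T with any? (λ v → T v ≟ᵇ true) | enumerate T
... | no none       | _ = FiniteVertices.empty-equidominating (finSum n) (λ v → ¬-not (λ v∈T → none (v , v∈T)))
... | yes (v , v∈T) | zero , e , inj , into , onto with onto v v∈T
...   | () , _
hereditary-relative G H T | yes _ | suc m , e , inj , into , onto =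
  transfer (image-embedding G e inj T into onto) {fsV = finSum (suc m)} {fsW = finSum _} (sum-image e inj T onto)
    (WholeGraph.toRelative (induced G e) (H m e inj))

universal-adj : ∀ {k} (G : Graph k) {u v} → Universal G u → v ≢ u → adj G v u ≡ true
universal-adj G {u} {v} U v≢u = trans (Graph.sym G v u) (U v v≢u)

universal-in : ∀ {k} (G : Graph k) {T : Fin k → Bool} {u} → Universal G u → T u ≡ true → UniversalIn (adj G) T u
universal-in G U u∈T = u∈T , λ v _ v≢u → U v v≢u

-- The right-side
-- versions follow by swapping the roles of G₁ and G₂.
module ChainJoinSide {n₁ n₂ : ℕ} (G₁ : Graph n₁) (G₂ : Graph n₂) (B : Fin n₁ → Fin n₂ → Bool)
  (chain : IsChainGraphOnUniversals G₁ G₂ B) (S₁ : Fin n₁ → Bool) (S₂ : Fin n₂ → Bool) where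

  V : Set
  V = Fin n₁ ⊎ Fin n₂

  A : V → V → Bool
  A = joinAdj G₁ G₂ B

  S : V → Bool
  S = [ S₁ , S₂ ]′

  left : (V → Bool) → Fin n₁ → Bool
  left D x = D (inj₁ x)

  right : (V → Bool) → Fin n₂ → Bool
  right D y = D (inj₂ y)

  B-universal₁ : ∀ {x y} → B x y ≡ true → Universal G₁ x
  B-universal₁ {x} {y} b = proj₁ (proj₁ chain x y b)

  B-universal₂ : ∀ {x y} → B x y ≡ true → Universal G₂ y
  B-universal₂ {x} {y} b = proj₂ (proj₁ chain x y b)

  B-nested₂ : ∀ {y y′} → Universal G₂ y → Universal G₂ y′ →
    (∀ x → B x y ≡ true → B x y′ ≡ true) ⊎ (∀ x → B x y′ ≡ true → B x y ≡ true)
  B-nested₂ {y} {y′} = proj₂ (proj₂ chain) y y′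

  join-dominates : ∀ {P Q} → Dominates (adj G₁) S₁ P → Dominates (adj G₂) S₂ Q → Dominates A S [ P , Q ]′
  join-dominates dom₁ dom₂ (inj₁ x) x∈S with dom₁ x x∈S
  ... | inj₁ p               = inj₁ p
  ... | inj₂ (u , u∈P , ux)  = inj₂ (inj₁ u , u∈P , ux)
  join-dominates dom₁ dom₂ (inj₂ y) y∈S with dom₂ y y∈S
  ... | inj₁ p               = inj₁ p
  ... | inj₂ (u , u∈Q , uy)  = inj₂ (inj₂ u , u∈Q , uy)

  -- If D dominates the chain-join and meets the left side, its left part
  -- dominates G₁[S₁]: a vertex dominated across B is universal in G₁.
  left-dominates-if-met : ∀ {D x₀} → Dominates A S D → D (inj₁ x₀) ≡ true → Dominates (adj G₁) S₁ (left D)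
  left-dominates-if-met {D} {x₀} dom x₀∈D x x∈S with dom (inj₁ x) x∈S
  ... | inj₁ p                       = inj₁ p
  ... | inj₂ (inj₁ u , u∈D , ux)     = inj₂ (u , u∈D , ux)
  ... | inj₂ (inj₂ y , _ , b) with x₀ ≟ᶠ x
  ...   | yes refl = inj₁ x₀∈D
  ...   | no x₀≢x  = inj₂ (x₀ , x₀∈D , universal-adj G₁ (B-universal₁ b) x₀≢x)

  LeftEmpty : (V → Bool) → Set
  LeftEmpty D = ¬ ∃ λ x → D (inj₁ x) ≡ true

  dominated-across : ∀ {D x} → Dominates A S D → LeftEmpty D → S₁ x ≡ true →
                     ∃ λ y → D (inj₂ y) ≡ true × B x y ≡ true
  dominated-across {x = x} dom empty x∈S with dom (inj₁ x) x∈S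
  ... | inj₁ x∈D                   = ⊥-elim (empty (x , x∈D))
  ... | inj₂ (inj₁ u , u∈D , _)    = ⊥-elim (empty (u , u∈D))
  ... | inj₂ (inj₂ y , y∈D , b)    = y , y∈D , b

  -- In an mds with empty left side, a right vertex y universal in G₂ is
  -- universal in the chain-join: a left vertex B-adjacent to another vertex
  -- y′ of D but not to y would force N_B(y) ⊆ N_B(y′), making y redundant.
  universal-if-left-empty : ∀ {D y} → IsMDSIn A S D → LeftEmpty D → D (inj₂ y) ≡ true →
                            Universal G₂ y → UniversalIn A S (inj₂ y)
  universal-if-left-empty {D} {y} M@(D⊆S , dom , _) empty y∈D Uy = D⊆S (inj₂ y) y∈D , adjacent
    where
    B-to-y : ∀ x → S₁ x ≡ true → B x y ≡ true
    B-to-y x x∈S with dominated-across dom empty x∈S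
    ... | y′ , y′∈D , b′ with B x y in bxy
    ...   | true  = refl
    ...   | false with B-nested₂ Uy (B-universal₂ b′)
    ...     | inj₂ y′⊆y = ⊥-elim (true≢false (y′⊆y x b′) bxy)
    ...     | inj₁ y⊆y′ = ⊥-elim (FiniteVertices.mds-irredundant (⊎-sum (finSum n₁) (finSum n₂))
                            M y∈D y′∈D y′≢y (Uy′ y y≢y′) cover)
      where
      Uy′ : Universal G₂ y′
      Uy′ = B-universal₂ b′
      y≢y′ : y ≢ y′
      y≢y′ refl = true≢false b′ bxy
      y′≢y : inj₂ y′ ≢ inj₂ y
      y′≢y refl = y≢y′ refl
      cover : ∀ v → S v ≡ true → A (inj₂ y) v ≡ true → v ≡ inj₂ y′ ⊎ A (inj₂ y′) v ≡ true
      cover (inj₁ u) _ b = inj₂ (y⊆y′ u b)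
      cover (inj₂ z) _ _ with z ≟ᶠ y′
      ... | yes refl = inj₁ refl
      ... | no z≢y′  = inj₂ (Uy′ z z≢y′)
    adjacent : ∀ v → S v ≡ true → v ≢ inj₂ y → A (inj₂ y) v ≡ true
    adjacent (inj₁ x) x∈S _   = B-to-y x x∈S
    adjacent (inj₂ z) _   z≢y = Uy z (λ z≡y → z≢y (cong inj₂ z≡y))

  left-met : ∀ {D x} → IsMDSIn A S D → NoUniversalIn A S D → S₁ x ≡ true → ∃ λ x₀ → D (inj₁ x₀) ≡ true
  left-met {D} M@(_ , dom , _) noU x∈S with any? (λ x → D (inj₁ x) ≟ᵇ true)
  ... | yes met  = met
  ... | no empty = let (y , y∈D , b) = dominated-across dom empty x∈S in
                   ⊥-elim (noU (inj₂ y) y∈D (universal-if-left-empty M empty y∈D (B-universal₂ b)))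

  left-dominates : ∀ {D} → IsMDSIn A S D → NoUniversalIn A S D → Dominates (adj G₁) S₁ (left D)
  left-dominates M@(_ , dom , _) noU x x∈S = left-dominates-if-met dom (proj₂ (left-met M noU x∈S)) x x∈S

  left-mds : ∀ {D} → IsMDSIn A S D → NoUniversalIn A S D → Dominates (adj G₂) S₂ (right D) →
             IsMDSIn (adj G₁) S₁ (left D)
  left-mds {D} M@(D⊆S , _ , minimal) noU dom₂ =
    (λ x → D⊆S (inj₁ x)) , left-dominates M noU ,
    λ P (P⊆D , x , x∈D , x∉P) dom₁ →
      minimal [ P , right D ]′ ((λ { (inj₁ u) → P⊆D u ; (inj₂ y) y∈D → y∈D }) , inj₁ x , x∈D , x∉P)
              (join-dominates dom₁ dom₂)

  left-essential : ∀ {D E x} → IsMDSIn (adj G₁) S₁ (left D) → IsMDSIn (adj G₂) S₂ (right D) →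
    NoUniversalIn A S D → E ⊆ D → D (inj₁ x) ≡ true → E (inj₁ x) ≡ false → ¬ Dominates A S E
  left-essential {D} {E} {x} (D₁⊆S , _ , minimal₁) M₂ noU E⊆D x∈D x∉E domE
    with any? (λ x → E (inj₁ x) ≟ᵇ true)
  ... | yes (x₂ , x₂∈E) = minimal₁ (left E) ((λ u → E⊆D (inj₁ u)) , x , x∈D , x∉E) (left-dominates-if-met domE x₂∈E)
  ... | no empty with dominated-across domE empty (D₁⊆S x x∈D)
  ...   | y , y∈E , b = noU (inj₂ y) y∈D (proj₁ M₂ y y∈D , adjacent)
    where
    Uy : Universal G₂ y
    Uy = B-universal₂ b
    y∈D : D (inj₂ y) ≡ true
    y∈D = E⊆D (inj₂ y) y∈E
    -- y is universal in G₂, so the right part of D is {y}; hence every left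
    -- vertex, being dominated across B by E ⊆ D, is B-adjacent to y
    only-y : ∀ {y′} → D (inj₂ y′) ≡ true → y′ ≡ y
    only-y {y′} y′∈D = FiniteVertices.∈⁅⁆ (finSum n₂)
      (trans (sym (FiniteVertices.mds-universal (finSum n₂) M₂ y∈D (universal-in G₂ Uy (proj₁ M₂ y y∈D)) y′)) y′∈D)
    adjacent : ∀ v → S v ≡ true → v ≢ inj₂ y → A (inj₂ y) v ≡ true
    adjacent (inj₁ u) u∈S _ with dominated-across domE empty u∈S
    ... | y′ , y′∈E , b′ = subst (λ z → B u z ≡ true) (only-y (E⊆D (inj₂ y′) y′∈E)) b′
    adjacent (inj₂ z) _ z≢y = Uy z (λ z≡y → z≢y (cong inj₂ z≡y))

module _ {n₁ n₂ : ℕ} {P : Fin n₁ ⊎ Fin n₂ → Set} (P? : ∀ v → Dec (P v)) where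

  all⊎? : Dec (∀ v → P v)
  all⊎? = map′ (λ (h₁ , h₂) → [ h₁ , h₂ ]) (λ h → h ∘ inj₁ , h ∘ inj₂) (all? (P? ∘ inj₁) ×-dec all? (P? ∘ inj₂))

  any⊎? : Dec (∃ P)
  any⊎? = map′ [ (λ (x , p) → inj₁ x , p) , (λ (y , p) → inj₂ y , p) ]′ (λ { (inj₁ x , p) → inj₁ (x , p) ; (inj₂ y , p) → inj₂ (y , p) })
                (any? (P? ∘ inj₁) ⊎-dec any? (P? ∘ inj₂))

chain-swap : ∀ {n₁ n₂} {G₁ : Graph n₁} {G₂ : Graph n₂} {B : Fin n₁ → Fin n₂ → Bool} →
  IsChainGraphOnUniversals G₁ G₂ B → IsChainGraphOnUniversals G₂ G₁ (flip B)
chain-swap (universal , nested₁ , nested₂) = (λ y x b → swap-× (universal x y b)) , nested₂ , nested₁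

module ChainJoin {n₁ n₂ : ℕ} (G₁ : Graph n₁) (G₂ : Graph n₂) (B : Fin n₁ → Fin n₂ → Bool)
  (chain : IsChainGraphOnUniversals G₁ G₂ B) (S₁ : Fin n₁ → Bool) (S₂ : Fin n₂ → Bool) where

  open ChainJoinSide G₁ G₂ B chain S₁ S₂ public
  private module Swapped = ChainJoinSide G₂ G₁ (flip B) (chain-swap {G₁ = G₁} {G₂} {B} chain) S₂ S₁

  fs : FiniteSum V
  fs = ⊎-sum (finSum n₁) (finSum n₂)


  swapping : Embedding Swapped.A Swapped.S A S
  swapping = record
    { to      = swap
    ; from    = swap
    ; from-to = swap-involutive
    ; to-from = λ v _ → swap-involutive v
    ; adj-to  = λ { (inj₁ a) (inj₁ b) → refl ; (inj₁ a) (inj₂ b) → refl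
                  ; (inj₂ a) (inj₁ b) → refl ; (inj₂ a) (inj₂ b) → refl }
    ; mem-to  = [ (λ _ → refl) , (λ _ → refl) ] }

  no-universal-swap : ∀ {D} → NoUniversalIn A S D → NoUniversalIn Swapped.A Swapped.S (D ∘ swap)
  no-universal-swap noU v v∈D U = noU (swap v) v∈D (universal-forth swapping U)

  right-dominates : ∀ {D} → IsMDSIn A S D → NoUniversalIn A S D → Dominates (adj G₂) S₂ (right D)
  right-dominates M noU = Swapped.left-dominates (mds-back swapping M) (no-universal-swap noU)

  mds⇔sides : ∀ {D} → D ⊆ S → NoUniversalIn A S D →
    IsMDSIn A S D ⇔ (IsMDSIn (adj G₁) S₁ (left D) × IsMDSIn (adj G₂) S₂ (right D))
  mds⇔sides {D} D⊆S noU = mk⇔ to from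
    where
    to : IsMDSIn A S D → IsMDSIn (adj G₁) S₁ (left D) × IsMDSIn (adj G₂) S₂ (right D)
    to M = left-mds M noU (right-dominates M noU) ,
           Swapped.left-mds (mds-back swapping M) (no-universal-swap noU) (left-dominates M noU)
    from : IsMDSIn (adj G₁) S₁ (left D) × IsMDSIn (adj G₂) S₂ (right D) → IsMDSIn A S D
    from (M₁ , M₂) = D⊆S , dominates-mono parts⊆D (join-dominates (proj₁ (proj₂ M₁)) (proj₁ (proj₂ M₂))) , minimal
      where
      parts⊆D : [ left D , right D ]′ ⊆ D
      parts⊆D = [ (λ _ p → p) , (λ _ p → p) ]
      minimal : ∀ E → E ⊊ D → ¬ Dominates A S E
      minimal E (E⊆D , inj₁ x , x∈D , x∉E) = left-essential M₁ M₂ noU E⊆D x∈D x∉E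
      minimal E (E⊆D , inj₂ y , y∈D , y∉E) domE =
        Swapped.left-essential M₂ M₁ (no-universal-swap noU) (λ v → E⊆D (swap v)) y∈D y∉E
          (dominates-back swapping (λ v v∈E → D⊆S v (E⊆D v v∈E)) domE)

  universal? : ∀ v → Dec (UniversalIn A S v)
  universal? v = (S v ≟ᵇ true) ×-dec
    all⊎? (λ u → (S u ≟ᵇ true) →-dec ¬? (FiniteSum._≟_ fs u v) →-dec (A v u ≟ᵇ true))

  open FiniteVertices fs using (⁅⁆-unique; universal-mds; mds-universal; weight-singleton; weight-pair)

  -- Universal
  -- vertices get weight T; other vertices keep the weights of G₂ on the
  -- right and get the weights of G₁ scaled by a on the left, where a
  -- exceeds every right-side weight, so T = t₁·a + t₂ can be decoded.
  chainJoin-equidominating : EquidominatingIn (finSum n₁) (adj G₁) S₁ → EquidominatingIn (finSum n₂) (adj G₂) S₂ →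
                             EquidominatingIn fs A S
  chainJoin-equidominating (w₁ , pos₁ , t₁ , char₁) (w₂ , pos₂ , t₂ , char₂) = w , pos , T , char
    where
    a : ℕ
    a = suc (sum w₂ + t₂)
    T : ℕ
    T = t₁ * a + t₂

    base : V → ℕ
    base (inj₁ x) = w₁ x * a
    base (inj₂ y) = w₂ y

    w : V → ℕ
    w v = if does (universal? v) then T else base v

    w-universal : ∀ {v} → UniversalIn A S v → w v ≡ T
    w-universal {v} U rewrite dec-true (universal? v) U = refl

    w-base : ∀ {v} → ¬ UniversalIn A S v → w v ≡ base v
    w-base {v} ¬U rewrite dec-false (universal? v) ¬U = refl

    T-positive : ∀ v → S v ≡ true → 1 ≤ T
    T-positive (inj₁ x) x∈S = ≤-trans (*-mono-≤ (FiniteVertices.target-positive (finSum n₁) char₁ x∈S) (s≤s z≤n)) (m≤m+n (t₁ * a) t₂)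
    T-positive (inj₂ y) y∈S = ≤-trans (FiniteVertices.target-positive (finSum n₂) char₂ y∈S) (m≤n+m t₂ (t₁ * a))

    pos : ∀ v → S v ≡ true → 1 ≤ w v
    pos v v∈S with universal? v
    ... | yes U  = subst (1 ≤_) (sym (w-universal U)) (T-positive v v∈S)
    ... | no  ¬U = subst (1 ≤_) (sym (w-base ¬U)) (base-positive v v∈S)
      where
      base-positive : ∀ v → S v ≡ true → 1 ≤ base v
      base-positive (inj₁ x) x∈S = *-mono-≤ (pos₁ x x∈S) (s≤s z≤n)
      base-positive (inj₂ y) y∈S = pos₂ y y∈S

    decompose : ∀ {D} → NoUniversalIn A S D →
      weightIn fs w D ≡ weightIn (finSum n₁) w₁ (left D) * a + weightIn (finSum n₂) w₂ (right D)
    decompose {D} noU = cong₂ _+_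
      (trans (FiniteSum.∑-cong (finSum n₁) scaled) (sym (*-distribʳ-sum a (λ x → if D (inj₁ x) then w₁ x else 0))))
      (FiniteSum.∑-cong (finSum n₂) kept)
      where
      scaled : ∀ x → (if D (inj₁ x) then w (inj₁ x) else 0) ≡ (if D (inj₁ x) then w₁ x else 0) * a
      scaled x with D (inj₁ x) in x∈D
      ... | true  = w-base (noU (inj₁ x) x∈D)
      ... | false = refl
      kept : ∀ y → (if D (inj₂ y) then w (inj₂ y) else 0) ≡ (if D (inj₂ y) then w₂ y else 0)
      kept y with D (inj₂ y) in y∈D
      ... | true  = w-base (noU (inj₂ y) y∈D)
      ... | false = refl

    -- right-side weights stay below a, so they are the remainder mod a
    right-light : ∀ Q → weightIn (finSum n₂) w₂ Q < a
    right-light Q = s≤s (≤-trans (sum-mono term≤) (m≤m+n (sum w₂) t₂))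
      where
      term≤ : ∀ y → (if Q y then w₂ y else 0) ≤ w₂ y
      term≤ y with Q y
      ... | true  = ≤-refl
      ... | false = z≤n

    t₂<a : t₂ < a
    t₂<a = s≤s (m≤n+m t₂ (sum w₂))

    -- D contains a universal vertex f: D is an mds iff D = {f} iff w(D) = T
    char-universal : ∀ {D f} → D ⊆ S → D f ≡ true → UniversalIn A S f → IsMDSIn A S D ⇔ weightIn fs w D ≡ T
    char-universal {D} {f} D⊆S f∈D Uf = mk⇔
      (λ M → trans (weight-singleton w (mds-universal M f∈D Uf)) (w-universal Uf))
      (λ wt → mds-cong (λ v → sym (⁅⁆-unique f∈D (only-f wt) v)) (universal-mds Uf))
      where
      open ≤-Reasoning
      only-f : weightIn fs w D ≡ T → ∀ v → D v ≡ true → v ≡ f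
      only-f wt v v∈D with FiniteSum._≟_ fs v f
      ... | yes v≡f = v≡f
      ... | no  v≢f = ⊥-elim (m+1+n≰m T (begin
        T + 1            ≤⟨ +-monoʳ-≤ T (pos v (D⊆S v v∈D)) ⟩
        T + w v          ≡⟨ cong (_+ w v) (sym (w-universal Uf)) ⟩
        w f + w v        ≤⟨ weight-pair w f∈D v∈D v≢f ⟩
        weightIn fs w D  ≡⟨ wt ⟩
        T                ∎))

    -- D has no universal vertex: D is an mds iff its parts are, iff
    -- w₁(left D) = t₁ and w₂(right D) = t₂, iff w(D) = T
    char-no-universal : ∀ {D} → D ⊆ S → NoUniversalIn A S D → IsMDSIn A S D ⇔ weightIn fs w D ≡ T
    char-no-universal {D} D⊆S noU = mk⇔
      (λ M → let (M₁ , M₂) = Equivalence.to sides M in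
        trans (decompose noU) (cong₂ (λ p q → p * a + q) (Equivalence.to char-left M₁) (Equivalence.to char-right M₂)))
      (λ wt → let (eq₁ , eq₂) = euclid-unique (right-light (right D)) t₂<a (trans (sym (decompose noU)) wt) in
        Equivalence.from sides (Equivalence.from char-left eq₁ , Equivalence.from char-right eq₂))
      where
      sides : IsMDSIn A S D ⇔ (IsMDSIn (adj G₁) S₁ (left D) × IsMDSIn (adj G₂) S₂ (right D))
      sides = mds⇔sides D⊆S noU
      char-left : IsMDSIn (adj G₁) S₁ (left D) ⇔ weightIn (finSum n₁) w₁ (left D) ≡ t₁
      char-left = char₁ (left D) (λ x → D⊆S (inj₁ x))
      char-right : IsMDSIn (adj G₂) S₂ (right D) ⇔ weightIn (finSum n₂) w₂ (right D) ≡ t₂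
      char-right = char₂ (right D) (λ y → D⊆S (inj₂ y))

    char : ∀ D → D ⊆ S → IsMDSIn A S D ⇔ weightIn fs w D ≡ T
    char D D⊆S with any⊎? (λ v → (D v ≟ᵇ true) ×-dec universal? v)
    ... | yes (f , f∈D , Uf) = char-universal D⊆S f∈D Uf
    ... | no  none           = char-no-universal D⊆S (λ v v∈D U → none (v , v∈D , U))

module _ {n₁ n₂ : ℕ} (G₁ : Graph n₁) (G₂ : Graph n₂) (B : Fin n₁ → Fin n₂ → Bool)
         (chain : IsChainGraphOnUniversals G₁ G₂ B) where

  joining : ∀ T → Embedding (joinAdj G₁ G₂ B) [ (λ x → T (x ↑ˡ n₂)) , (λ y → T (n₁ ↑ʳ y)) ] (adj (chainJoin G₁ G₂ B)) T
  joining T = record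
    { to = join n₁ n₂ ; from = splitAt n₁ ; from-to = splitAt-join n₁ n₂ ; to-from = λ v _ → join-splitAt n₁ n₂ v
    ; adj-to = adj-join ; mem-to = [ (λ _ → refl) , (λ _ → refl) ] }
    where
    adj-join : ∀ x y → adj (chainJoin G₁ G₂ B) (join n₁ n₂ x) (join n₁ n₂ y) ≡ joinAdj G₁ G₂ B x y
    adj-join x y rewrite splitAt-join n₁ n₂ x | splitAt-join n₁ n₂ y = refl

  chainJoin-relative : ∀ T → EquidominatingIn (finSum n₁) (adj G₁) (λ x → T (x ↑ˡ n₂)) →
    EquidominatingIn (finSum n₂) (adj G₂) (λ y → T (n₁ ↑ʳ y)) → EquidominatingIn (finSum (n₁ + n₂)) (adj (chainJoin G₁ G₂ B)) T
  chainJoin-relative T E₁ E₂ =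
    transfer (joining T) {fsV = ⊎-sum (finSum n₁) (finSum n₂)} {fsW = finSum (n₁ + n₂)} (λ g _ → sum-splitAt n₁ g)
    (ChainJoin.chainJoin-equidominating G₁ G₂ B chain _ _ E₁ E₂)

-- Lemma 8.4.  For the whole graph take T = all vertices.  For an induced
-- subgraph given by an injection f, take T = image of f: both sides are
-- equidominating on their parts of T by heredity, hence so is G[T], and
-- the induced subgraph is G[T] along f.
lemma8p4 : ∀ {n₁ n₂ : ℕ} (G₁ : Graph n₁) (G₂ : Graph n₂) (B : Fin n₁ → Fin n₂ → Bool) →
    IsChainGraphOnUniversals G₁ G₂ B →
    (Equidominating G₁ → Equidominating G₂ → Equidominating (chainJoin G₁ G₂ B)) ×
    (HereditarilyEquidominating G₁ → HereditarilyEquidominating G₂ →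
      HereditarilyEquidominating (chainJoin G₁ G₂ B))
lemma8p4 {n₁} {n₂} G₁ G₂ B chain = equidominating , hereditary
  where
  G : Graph (n₁ + n₂)
  G = chainJoin G₁ G₂ B
  equidominating : Equidominating G₁ → Equidominating G₂ → Equidominating G
  equidominating E₁ E₂ = WholeGraph.fromRelative G (equidominating-vertex G₁ E₁ ↑ˡ n₂)
    (chainJoin-relative G₁ G₂ B chain full (WholeGraph.toRelative G₁ E₁) (WholeGraph.toRelative G₂ E₂))
  hereditary : HereditarilyEquidominating G₁ → HereditarilyEquidominating G₂ → HereditarilyEquidominating G
  hereditary H₁ H₂ m f inj = WholeGraph.fromRelative (induced G f) zero
    (transfer⁻¹ (image-embedding G f inj (Image f) (in-image f) (image-onto f))
       {fsV = finSum (suc m)} {fsW = finSum (n₁ + n₂)} (sum-image f inj (Image f) (image-onto f))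
       (chainJoin-relative G₁ G₂ B chain (Image f) (hereditary-relative G₁ H₁ _) (hereditary-relative G₂ H₂ _)))
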